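{- There exist finite posets $P$ and $Q$ such that the minimum number of uniantichains needed to cover $P\times Q$ is strictly larger than the maximum size of a semichain in $P\times Q$.
   Context: The product $P\times Q$ is ordered componentwise. A uniantichain is an antichain of $P\times Q$ of the form $\{p\}\times A$ with $A$ an antichain of $Q$, or $A\times\{q\}$ with $A$ an antichain of $P$. A uniantichain covering is a family of uniantichains whose union is $P\times Q$. A semichain is a set $T\subseteq P\times Q$ such that no two distinct elements of $T$ lie in a common uniantichain. -}

module Defs where

open import Level using (0ℓ)
open import Data.Nat using (ℕ; _≤_; _<_)
open import Data.Fin using (Fin)
open import Data.Product using (Σ; ∃; ∃-syntax; _×_; _,_; proj₁; proj₂)
open import Data.Sum using (_⊎_)
open import Data.List using (List; length)
open import Data.List.Membership.Propositional using (_∈_)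
open import Data.List.Relation.Unary.Unique.Propositional using (Unique)
open import Relation.Binary using (Rel; IsPartialOrder)
open import Relation.Binary.PropositionalEquality using (_≡_)
open import Relation.Nullary using (¬_)
open import Relation.Unary using (Pred) renaming (_∈_ to _∈ₛ_)
open import Function.Bundles using (_⇔_)

record FinPoset : Set₁ where
  field
    size           : ℕ
    _≼_            : Rel (Fin size) 0ℓ
    isPartialOrder : IsPartialOrder _≡_ _≼_

open FinPoset public

Elt : FinPoset → Set
Elt P = Fin (size P)

-- Elements of P × Q (ordered componentwise; the order itself is not
-- needed below since uniantichains are defined via antichains of P, Q).
Pair : FinPoset → FinPoset → Set
Pair P Q = Elt P × Elt Q

IsAntichain : (P : FinPoset) → Pred (Elt P) 0ℓ → Set
IsAntichain P A = ∀ {a b} → a ∈ₛ A → b ∈ₛ A → _≼_ P a b → a ≡ b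

IsUniantichain : (P Q : FinPoset) → Pred (Pair P Q) 0ℓ → Set₁
IsUniantichain P Q U =
    (Σ (Elt P) λ p → Σ (Pred (Elt Q) 0ℓ) λ A → IsAntichain Q A ×
       (∀ x → (x ∈ₛ U) ⇔ ((proj₁ x ≡ p) × (proj₂ x ∈ₛ A))))
  ⊎ (Σ (Elt Q) λ q → Σ (Pred (Elt P) 0ℓ) λ A → IsAntichain P A ×
       (∀ x → (x ∈ₛ U) ⇔ ((proj₁ x ∈ₛ A) × (proj₂ x ≡ q))))

Uniantichain : FinPoset → FinPoset → Set₁
Uniantichain P Q = Σ (Pred (Pair P Q) 0ℓ) (IsUniantichain P Q)

IsUniantichainCovering : (P Q : FinPoset) (k : ℕ) → (Fin k → Uniantichain P Q) → Set
IsUniantichainCovering P Q k F = ∀ (x : Pair P Q) → ∃[ i ] (x ∈ₛ proj₁ (F i))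

HasCoveringOfSize : (P Q : FinPoset) → ℕ → Set₁
HasCoveringOfSize P Q k = Σ (Fin k → Uniantichain P Q) (IsUniantichainCovering P Q k)

IsMinCoverNumber : (P Q : FinPoset) → ℕ → Set₁
IsMinCoverNumber P Q k =
  HasCoveringOfSize P Q k × (∀ j → HasCoveringOfSize P Q j → k ≤ j)

IsSemichain : (P Q : FinPoset) → List (Pair P Q) → Set₁
IsSemichain P Q T =
  Unique T ×
  (∀ {x y} → x ∈ T → y ∈ T → ¬ (x ≡ y) →
     ¬ (Σ (Uniantichain P Q) λ U → (x ∈ₛ proj₁ U) × (y ∈ₛ proj₁ U)))

IsMaxSemichainSize : (P Q : FinPoset) → ℕ → Set₁
IsMaxSemichainSize P Q s =
  (Σ (List (Pair P Q)) λ T → IsSemichain P Q T × (length T ≡ s)) ×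
  (∀ T → IsSemichain P Q T → length T ≤ s)

-- The pair P, Q below has fractional uniantichain-covering number 39/2. The weighting
-- `weight` has total 39 and puts weight at most 2 on every antichain of a row {p} × Q or
-- of a column P × {q}, hence on every uniantichain, so every covering of P × Q needs at
-- least 39/2, i.e. 20, uniantichains. Dually, the 39 uniantichains of `doubleCover` cover
-- every point twice, while a semichain meets each uniantichain at most once, so a
-- semichain has at most 39/2, i.e. 19, points. An explicit covering by 20 uniantichains
-- and an explicit semichain of 19 points make both bounds exact.

module Submission where

open import Defs
open import Level using (0ℓ)
open import Function.Base using (_∘_; id)
open import Function.Bundles using (mk⇔; Equivalence)
open import Data.Bool.Base using (Bool; true; false; T; if_then_else_)
open import Data.Nat.Base using (ℕ; zero; suc; _+_; _*_; _≤_; _<_; z≤n; s≤s)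
open import Data.Nat.Properties
  using ( module ≤-Reasoning; _≤?_; +-0-commutativeMonoid; +-mono-≤; +-identityʳ; *-identityʳ
        ; ≤-refl; ≤-reflexive; ≤-pred; *-cancelʳ-<)
open import Algebra.Properties.CommutativeMonoid.Sum +-0-commutativeMonoid
  using (sum; sum-syntax; ∑-comm; sum-cong-≗; sum-replicate-zero)
open import Data.Fin.Base using (Fin; zero; suc)
open import Data.Fin.Patterns
open import Data.Fin.Properties using (_≟_; suc-injective; 0≢1+n; all?; any?)
open import Data.Product.Properties using (≡-dec)
open import Data.Fin.Subset using (Subset)
open import Data.Fin.Subset.Properties using (anySubset?)
open import Data.Vec.Base using (Vec; lookup; tabulate; []; _∷_)
open import Data.Vec.Properties using (lookup∘tabulate)
open import Data.Product.Base using (Σ; ∃; _×_; _,_; proj₁; proj₂)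
open import Data.Sum.Base using (_⊎_; inj₁; inj₂)
open import Data.Empty using (⊥-elim)
open import Data.List.Base using (List; []; _∷_; length)
import Data.List.Base as List
open import Data.List.Membership.Propositional using (_∈_)
open import Data.List.Membership.Propositional.Properties using (∈-lookup)
open import Data.List.Relation.Unary.All as All using (All; _∷_)
import Data.List.Relation.Unary.Any as Any
open import Data.List.Relation.Unary.Unique.Propositional using (Unique)
open import Data.List.Relation.Unary.AllPairs using (_∷_; allPairs?)
open import Relation.Binary.PropositionalEquality
  using (_≡_; _≢_; _≗_; refl; sym; trans; cong; cong₂; subst; isEquivalence; module ≡-Reasoning)
open import Relation.Nullary using (¬_; Dec; yes; no)
open import Relation.Nullary.Decidable
  using ( ⌊_⌋; True; toWitness; isYes≗does; dec-true; map′; decidable-stable; ¬?; T?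
        ; _×-dec_; _⊎-dec_; _→-dec_)
open import Relation.Unary using (Pred) renaming (_∈_ to _∈ₛ_)

infixr 11 [_]·_

[_]·_ : Bool → ℕ → ℕ
[ b ]· v = if b then v else 0

[]·-vanishes : ∀ {b} v → ¬ T b → [ b ]· v ≡ 0
[]·-vanishes {true}  v ¬b = ⊥-elim (¬b _)
[]·-vanishes {false} v ¬b = refl

∑-mono-≤ : ∀ {n} {f g : Fin n → ℕ} → (∀ i → f i ≤ g i) → sum f ≤ sum g
∑-mono-≤ {zero}  _   = z≤n
∑-mono-≤ {suc n} f≤g = +-mono-≤ (f≤g zero) (∑-mono-≤ (f≤g ∘ suc))

∑-const : ∀ n c → ∑[ i < n ] c ≡ n * c
∑-const zero    c = refl
∑-const (suc n) c = cong (c +_) (∑-const n c)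

∑-zero : ∀ {n} {f : Fin n → ℕ} → (∀ i → f i ≡ 0) → sum f ≡ 0
∑-zero {n} f≡0 = trans (sum-cong-≗ f≡0) (sum-replicate-zero n)

∑-concentrated : ∀ {n} (f : Fin n → ℕ) j → (∀ i → i ≢ j → f i ≡ 0) → sum f ≡ f j
∑-concentrated f zero    vanish =
  trans (cong (f zero +_) (∑-zero (λ i → vanish (suc i) λ ()))) (+-identityʳ (f zero))
∑-concentrated f (suc j) vanish =
  cong₂ _+_ (vanish zero λ ())
            (∑-concentrated (f ∘ suc) j (λ i i≢j → vanish (suc i) (i≢j ∘ suc-injective)))

∑-indicator : ∀ {k} (j : Fin k) v → ∑[ i < k ] [ ⌊ j ≟ i ⌋ ]· v ≡ v
∑-indicator j v =
  trans (∑-concentrated _ j (λ i i≢j → []·-vanishes v (i≢j ∘ sym ∘ toWitness)))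
        (cong ([_]· v) (trans (isYes≗does (j ≟ j)) (dec-true (j ≟ j) refl)))

∑-indicator≤1 : ∀ {n} (b : Fin n → Bool) → (∀ {i j} → T (b i) → T (b j) → i ≡ j) →
                ∑[ i < n ] [ b i ]· 1 ≤ 1
∑-indicator≤1 {zero}  b b-unique = z≤n
∑-indicator≤1 {suc n} b b-unique with b zero in b₀
... | true  = ≤-reflexive (cong suc (∑-zero λ i →
                []·-vanishes {b (suc i)} 1 (0≢1+n ∘ b-unique (subst T (sym b₀) _))))
... | false = ∑-indicator≤1 (b ∘ suc) (λ bi bj → suc-injective (b-unique bi bj))

lookup-injective : ∀ {A : Set} {xs : List A} → Unique xs →
                   ∀ {i j} → List.lookup xs i ≡ List.lookup xs j → i ≡ j
lookup-injective (_    ∷ _) {zero}  {zero}  _  = refl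
lookup-injective (x∉xs ∷ _) {zero}  {suc j} eq = ⊥-elim (All.lookup x∉xs (∈-lookup j) eq)
lookup-injective (x∉xs ∷ _) {suc i} {zero}  eq = ⊥-elim (All.lookup x∉xs (∈-lookup i) (sym eq))
lookup-injective (_    ∷ u) {suc i} {suc j} eq = cong suc (lookup-injective u eq)

∀-Subset? : ∀ {n} {Φ : Pred (Subset n) 0ℓ} → (∀ B → Dec (Φ B)) → Dec (∀ B → Φ B)
∀-Subset? Φ? = map′ (λ ∄¬Φ B → decidable-stable (Φ? B) (λ ¬ΦB → ∄¬Φ (B , ¬ΦB)))
                    (λ ∀Φ (B , ¬ΦB) → ¬ΦB (∀Φ B))
                    (¬? (anySubset? (¬? ∘ Φ?)))

_∈?_ : ∀ {n} (a : Fin n) (A : List (Fin n)) → Dec (a ∈ A)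
a ∈? A = Any.any? (a ≟_) A

Comparable : (P : FinPoset) → Elt P → Elt P → Set
Comparable P a b = _≼_ P a b ⊎ _≼_ P b a

antichain-comparable⇒≡ : ∀ {P A a b} → IsAntichain P A → a ∈ₛ A → b ∈ₛ A →
                         Comparable P a b → a ≡ b
antichain-comparable⇒≡ A-anti a∈A b∈A (inj₁ a≼b) = A-anti a∈A b∈A a≼b
antichain-comparable⇒≡ A-anti a∈A b∈A (inj₂ b≼a) = sym (A-anti b∈A a∈A b≼a)

comparable? : ∀ P → (∀ a b → Dec (_≼_ P a b)) → ∀ a b → Dec (Comparable P a b)
comparable? P _≼?_ a b = (a ≼? b) ⊎-dec (b ≼? a)

isAntichain? : ∀ P → (∀ a b → Dec (_≼_ P a b)) →
               ∀ {A} → (∀ a → Dec (A a)) → Dec (IsAntichain P A)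
isAntichain? P _≼?_ A? = map′ (λ anti {a} {b} → anti a b) (λ anti a b → anti)
  (all? λ a → all? λ b → A? a →-dec (A? b →-dec (a ≼? b →-dec a ≟ b)))

AntichainWeight≤ : (P : FinPoset) → (Elt P → ℕ) → ℕ → Set
AntichainWeight≤ P f D =
  ∀ (A : Elt P → Bool) → IsAntichain P (T ∘ A) → ∑[ a < size P ] [ A a ]· f a ≤ D

antichainWeight≤-from-subsets : ∀ {P f D} →
  (∀ (B : Subset (size P)) → IsAntichain P (T ∘ lookup B) →
     ∑[ a < size P ] [ lookup B a ]· f a ≤ D) →
  AntichainWeight≤ P f D
antichainWeight≤-from-subsets {P} {f} {D} bound A A-anti =
  subst (_≤ D) (sum-cong-≗ (λ a → cong ([_]· f a) (B≗A a)))
        (bound B (λ a∈B b∈B → A-anti (subst T (B≗A _) a∈B) (subst T (B≗A _) b∈B)))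
  where
  B : Subset (size P)
  B = tabulate A
  B≗A : lookup B ≗ A
  B≗A = lookup∘tabulate A

module Product (P Q : FinPoset) where

  total : (Pair P Q → ℕ) → ℕ
  total w = ∑[ p < size P ] ∑[ q < size Q ] w (p , q)

  AntichainWeightBound : (Pair P Q → ℕ) → ℕ → Set
  AntichainWeightBound w D =
    (∀ p → AntichainWeight≤ Q (λ q → w (p , q)) D) ×
    (∀ q → AntichainWeight≤ P (λ p → w (p , q)) D)

  uniantichain-weight-≤ : ∀ {w D U} (B : Pair P Q → Bool) → AntichainWeightBound w D →
                          IsUniantichain P Q U → (∀ {x} → T (B x) → x ∈ₛ U) →
                          total (λ x → [ B x ]· w x) ≤ D
  uniantichain-weight-≤ {w} {D} B (rows , _) (inj₁ (p₀ , A , A-anti , U⇔)) B⊆U = begin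
      total (λ x → [ B x ]· w x)
    ≡⟨ ∑-concentrated _ p₀ (λ p p≢p₀ →
         ∑-zero (λ q → []·-vanishes (w (p , q)) (p≢p₀ ∘ on-row))) ⟩
      ∑[ q < size Q ] [ B (p₀ , q) ]· w (p₀ , q)
    ≤⟨ rows p₀ (λ q → B (p₀ , q)) (λ Ba Bb → A-anti (in-A Ba) (in-A Bb)) ⟩
      D ∎
    where
    open ≤-Reasoning
    on-row : ∀ {x} → T (B x) → proj₁ x ≡ p₀
    on-row Bx = proj₁ (Equivalence.to (U⇔ _) (B⊆U Bx))
    in-A : ∀ {x} → T (B x) → proj₂ x ∈ₛ A
    in-A Bx = proj₂ (Equivalence.to (U⇔ _) (B⊆U Bx))
  uniantichain-weight-≤ {w} {D} B (_ , cols) (inj₂ (q₀ , A , A-anti , U⇔)) B⊆U = begin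
      total (λ x → [ B x ]· w x)
    ≡⟨ ∑-comm (λ p q → [ B (p , q) ]· w (p , q)) ⟩
      ∑[ q < size Q ] ∑[ p < size P ] [ B (p , q) ]· w (p , q)
    ≡⟨ ∑-concentrated _ q₀ (λ q q≢q₀ →
         ∑-zero (λ p → []·-vanishes (w (p , q)) (q≢q₀ ∘ on-column))) ⟩
      ∑[ p < size P ] [ B (p , q₀) ]· w (p , q₀)
    ≤⟨ cols q₀ (λ p → B (p , q₀)) (λ Ba Bb → A-anti (in-A Ba) (in-A Bb)) ⟩
      D ∎
    where
    open ≤-Reasoning
    on-column : ∀ {x} → T (B x) → proj₂ x ≡ q₀
    on-column Bx = proj₂ (Equivalence.to (U⇔ _) (B⊆U Bx))
    in-A : ∀ {x} → T (B x) → proj₁ x ∈ₛ A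
    in-A Bx = proj₁ (Equivalence.to (U⇔ _) (B⊆U Bx))

  total-by-fibres : ∀ {k} (w : Pair P Q → ℕ) (idx : Pair P Q → Fin k) →
                    total w ≡ ∑[ i < k ] total (λ x → [ ⌊ idx x ≟ i ⌋ ]· w x)
  total-by-fibres {k} w idx = begin
      total w
    ≡⟨ sum-cong-≗ (λ p → sum-cong-≗ (λ q → sym (∑-indicator (idx (p , q)) (w (p , q))))) ⟩
      ∑[ p < size P ] ∑[ q < size Q ] ∑[ i < k ] [ ⌊ idx (p , q) ≟ i ⌋ ]· w (p , q)
    ≡⟨ sum-cong-≗ (λ p → ∑-comm (λ q i → [ ⌊ idx (p , q) ≟ i ⌋ ]· w (p , q))) ⟩
      ∑[ p < size P ] ∑[ i < k ] ∑[ q < size Q ] [ ⌊ idx (p , q) ≟ i ⌋ ]· w (p , q)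
    ≡⟨ ∑-comm (λ p i → ∑[ q < size Q ] [ ⌊ idx (p , q) ≟ i ⌋ ]· w (p , q)) ⟩
      ∑[ i < k ] total (λ x → [ ⌊ idx x ≟ i ⌋ ]· w x) ∎
    where open ≡-Reasoning

  total-weight-≤-cover-size : ∀ {w D k} → AntichainWeightBound w D → HasCoveringOfSize P Q k →
                              total w ≤ k * D
  total-weight-≤-cover-size {w} {D} {k} bound (F , covers) = begin
      total w
    ≡⟨ total-by-fibres w idx ⟩
      ∑[ i < k ] total (λ x → [ ⌊ idx x ≟ i ⌋ ]· w x)
    ≤⟨ ∑-mono-≤ (λ i → uniantichain-weight-≤ _ bound (proj₂ (F i)) (fibre⊆F i)) ⟩
      ∑[ i < k ] D
    ≡⟨ ∑-const k D ⟩
      k * D ∎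
    where
    open ≤-Reasoning
    idx : Pair P Q → Fin k
    idx x = proj₁ (covers x)
    fibre⊆F : ∀ i {x} → T ⌊ idx x ≟ i ⌋ → x ∈ₛ proj₁ (F i)
    fibre⊆F i {x} idx≡i = subst (λ j → x ∈ₛ proj₁ (F j)) (toWitness idx≡i) (proj₂ (covers x))

  -- Rows {p₀} × A and columns A × {q₀} with A listed, so that membership is decidable.
  data Line : Set where
    row : Elt P → List (Elt Q) → Line
    col : Elt Q → List (Elt P) → Line

  _∈ᴸ_ : Pair P Q → Line → Set
  x ∈ᴸ row p₀ A = proj₁ x ≡ p₀ × proj₂ x ∈ A
  x ∈ᴸ col q₀ A = proj₁ x ∈ A × proj₂ x ≡ q₀

  _∈ᴸ?_ : ∀ x L → Dec (x ∈ᴸ L)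
  x ∈ᴸ? row p₀ A = (proj₁ x ≟ p₀) ×-dec proj₂ x ∈? A
  x ∈ᴸ? col q₀ A = proj₁ x ∈? A ×-dec (proj₂ x ≟ q₀)

  IsAntichainLine : Line → Set
  IsAntichainLine (row _ A) = IsAntichain Q (_∈ A)
  IsAntichainLine (col _ A) = IsAntichain P (_∈ A)

  line-isUniantichain : ∀ L → IsAntichainLine L → IsUniantichain P Q (_∈ᴸ L)
  line-isUniantichain (row p₀ A) A-anti = inj₁ (p₀ , (_∈ A) , A-anti , λ _ → mk⇔ id id)
  line-isUniantichain (col q₀ A) A-anti = inj₂ (q₀ , (_∈ A) , A-anti , λ _ → mk⇔ id id)

  uniantichain : (L : Line) → IsAntichainLine L → Uniantichain P Q
  uniantichain L L-anti = (_∈ᴸ L) , line-isUniantichain L L-anti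

  multiplicity : ∀ {r} → (Fin r → Line) → Pair P Q → ℕ
  multiplicity {r} V x = ∑[ t < r ] [ ⌊ x ∈ᴸ? V t ⌋ ]· 1

  semichain-length-≤ : ∀ {r D Ts} (V : Fin r → Line) → (∀ t → IsAntichainLine (V t)) →
                       (∀ x → D ≤ multiplicity V x) → IsSemichain P Q Ts → length Ts * D ≤ r
  semichain-length-≤ {r} {D} {Ts} V V-anti covered (Ts-unique , Ts-semichain) = begin
      length Ts * D
    ≡⟨ ∑-const (length Ts) D ⟨
      ∑[ j < length Ts ] D
    ≤⟨ ∑-mono-≤ (covered ∘ x) ⟩
      ∑[ j < length Ts ] ∑[ t < r ] [ ⌊ x j ∈ᴸ? V t ⌋ ]· 1
    ≡⟨ ∑-comm (λ j t → [ ⌊ x j ∈ᴸ? V t ⌋ ]· 1) ⟩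
      ∑[ t < r ] ∑[ j < length Ts ] [ ⌊ x j ∈ᴸ? V t ⌋ ]· 1
    ≤⟨ ∑-mono-≤ (λ t → ∑-indicator≤1 _ (meets-once t)) ⟩
      ∑[ t < r ] 1
    ≡⟨ trans (∑-const r 1) (*-identityʳ r) ⟩
      r ∎
    where
    open ≤-Reasoning
    x : Fin (length Ts) → Pair P Q
    x = List.lookup Ts
    meets-once : ∀ t {i j} → T ⌊ x i ∈ᴸ? V t ⌋ → T ⌊ x j ∈ᴸ? V t ⌋ → i ≡ j
    meets-once t {i} {j} xi∈Vt xj∈Vt with i ≟ j
    ... | yes i≡j = i≡j
    ... | no  i≢j = ⊥-elim (Ts-semichain (∈-lookup i) (∈-lookup j)
                              (i≢j ∘ lookup-injective Ts-unique)
                              (uniantichain (V t) (V-anti t) , toWitness xi∈Vt , toWitness xj∈Vt))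

  Separated : Pair P Q → Pair P Q → Set
  Separated (p , q) (p′ , q′) = (p ≡ p′ → Comparable Q q q′) × (q ≡ q′ → Comparable P p p′)

  separated⇒¬co-uniantichain : ∀ {x y} → x ≢ y → Separated x y →
                               ¬ Σ (Uniantichain P Q) λ U → x ∈ₛ proj₁ U × y ∈ₛ proj₁ U
  separated⇒¬co-uniantichain {_ , _} {_ , _} x≢y (same-row , _)
                             ((_ , inj₁ (_ , _ , A-anti , U⇔)) , x∈U , y∈U)
    with (p≡p₀ , q∈A) ← Equivalence.to (U⇔ _) x∈U
       | (p′≡p₀ , q′∈A) ← Equivalence.to (U⇔ _) y∈U
    = let p≡p′ = trans p≡p₀ (sym p′≡p₀) in
      x≢y (cong₂ _,_ p≡p′ (antichain-comparable⇒≡ {Q} A-anti q∈A q′∈A (same-row p≡p′)))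
  separated⇒¬co-uniantichain {_ , _} {_ , _} x≢y (_ , same-column)
                             ((_ , inj₂ (_ , _ , A-anti , U⇔)) , x∈U , y∈U)
    with (p∈A , q≡q₀) ← Equivalence.to (U⇔ _) x∈U
       | (p′∈A , q′≡q₀) ← Equivalence.to (U⇔ _) y∈U
    = let q≡q′ = trans q≡q₀ (sym q′≡q₀) in
      x≢y (cong₂ _,_ (antichain-comparable⇒≡ {P} A-anti p∈A p′∈A (same-column q≡q′)) q≡q′)

  separated⇒semichain : ∀ {Ts} → Unique Ts → All (λ x → All (Separated x) Ts) Ts →
                        IsSemichain P Q Ts
  separated⇒semichain Ts-unique separated = Ts-unique , λ x∈Ts y∈Ts x≢y →
    separated⇒¬co-uniantichain x≢y (All.lookup (All.lookup separated x∈Ts) y∈Ts)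

  module Decide (_≼P?_ : ∀ a b → Dec (_≼_ P a b)) (_≼Q?_ : ∀ a b → Dec (_≼_ Q a b)) where

    isAntichainLine? : ∀ L → Dec (IsAntichainLine L)
    isAntichainLine? (row _ A) = isAntichain? Q _≼Q?_ (_∈? A)
    isAntichainLine? (col _ A) = isAntichain? P _≼P?_ (_∈? A)

    separated? : ∀ x y → Dec (Separated x y)
    separated? (p , q) (p′ , q′) =
      (p ≟ p′ →-dec comparable? Q _≼Q?_ q q′) ×-dec (q ≟ q′ →-dec comparable? P _≼P?_ p p′)

module UpSets {n : ℕ} (up : Fin n → List (Fin n)) where

  _⊑_ : Fin n → Fin n → Set
  a ⊑ b = b ∈ up a

  _⊑?_ : ∀ a b → Dec (a ⊑ b)
  a ⊑? b = b ∈? up a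

  reflexive? : Dec (∀ a → a ⊑ a)
  reflexive? = all? λ a → a ⊑? a

  antisymmetric? : Dec (∀ a b → a ⊑ b → b ⊑ a → a ≡ b)
  antisymmetric? = all? λ a → all? λ b → a ⊑? b →-dec (b ⊑? a →-dec a ≟ b)

  transitive? : Dec (∀ a b c → a ⊑ b → b ⊑ c → a ⊑ c)
  transitive? = all? λ a → all? λ b → all? λ c → a ⊑? b →-dec (b ⊑? c →-dec a ⊑? c)

  poset : True reflexive? → True antisymmetric? → True transitive? → FinPoset
  poset refl-ok antisym-ok trans-ok = record
    { size           = n
    ; _≼_            = _⊑_
    ; isPartialOrder = record
      { isPreorder = record
        { isEquivalence = isEquivalence
        ; reflexive     = λ { refl → toWitness refl-ok _ }
        ; trans         = toWitness trans-ok _ _ _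
        }
      ; antisym = toWitness antisym-ok _ _
      }
    }

upP : Fin 6 → List (Fin 6)
upP 0F = 0F ∷ 2F ∷ 3F ∷ 4F ∷ 5F ∷ []
upP 1F = 1F ∷ 3F ∷ 4F ∷ []
upP 2F = 2F ∷ 3F ∷ 4F ∷ 5F ∷ []
upP 3F = 3F ∷ 4F ∷ []
upP 4F = 4F ∷ []
upP 5F = 5F ∷ []

upQ : Fin 8 → List (Fin 8)
upQ 0F = 0F ∷ 2F ∷ 5F ∷ 6F ∷ 7F ∷ []
upQ 1F = 1F ∷ 3F ∷ 6F ∷ 7F ∷ []
upQ 2F = 2F ∷ 5F ∷ 6F ∷ 7F ∷ []
upQ 3F = 3F ∷ 6F ∷ []
upQ 4F = 4F ∷ 5F ∷ 6F ∷ []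
upQ 5F = 5F ∷ 6F ∷ []
upQ 6F = 6F ∷ []
upQ 7F = 7F ∷ []

P Q : FinPoset
P = UpSets.poset upP _ _ _
Q = UpSets.poset upQ _ _ _

open UpSets upP using () renaming (_⊑?_ to _≼P?_)
open UpSets upQ using () renaming (_⊑?_ to _≼Q?_)
open Product P Q
open Decide _≼P?_ _≼Q?_

weight : Pair P Q → ℕ
weight (p , q) = lookup (lookup table p) q
  where
  table : Vec (Vec ℕ 8) 6
  table = (2 ∷ 0 ∷ 2 ∷ 0 ∷ 0 ∷ 2 ∷ 2 ∷ 0 ∷ [])
        ∷ (0 ∷ 2 ∷ 0 ∷ 2 ∷ 0 ∷ 0 ∷ 0 ∷ 0 ∷ [])
        ∷ (2 ∷ 0 ∷ 2 ∷ 0 ∷ 0 ∷ 2 ∷ 2 ∷ 0 ∷ [])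
        ∷ (1 ∷ 1 ∷ 1 ∷ 1 ∷ 0 ∷ 1 ∷ 2 ∷ 0 ∷ [])
        ∷ (1 ∷ 1 ∷ 1 ∷ 1 ∷ 0 ∷ 1 ∷ 2 ∷ 0 ∷ [])
        ∷ (1 ∷ 0 ∷ 1 ∷ 0 ∷ 1 ∷ 1 ∷ 0 ∷ 1 ∷ [])
        ∷ []

weight-bound : AntichainWeightBound weight 2
weight-bound = (λ p → antichainWeight≤-from-subsets {Q} {λ q → weight (p , q)} (row-bounds p))
             , (λ q → antichainWeight≤-from-subsets {P} {λ p → weight (p , q)} (column-bounds q))
  where
  row-bounds : ∀ p (B : Subset 8) → IsAntichain Q (T ∘ lookup B) →
               ∑[ q < 8 ] [ lookup B q ]· weight (p , q) ≤ 2
  row-bounds = toWitness {a? = all? λ p → ∀-Subset? λ B →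
                                 isAntichain? Q _≼Q?_ (T? ∘ lookup B) →-dec (_ ≤? 2)} _
  column-bounds : ∀ q (B : Subset 6) → IsAntichain P (T ∘ lookup B) →
                  ∑[ p < 6 ] [ lookup B p ]· weight (p , q) ≤ 2
  column-bounds = toWitness {a? = all? λ q → ∀-Subset? λ B →
                                    isAntichain? P _≼P?_ (T? ∘ lookup B) →-dec (_ ≤? 2)} _

cover : Fin 20 → Line
cover = lookup
  ( row 0F (0F ∷ 1F ∷ 4F ∷ [])
  ∷ row 0F (3F ∷ 5F ∷ 7F ∷ [])
  ∷ row 1F (0F ∷ 1F ∷ 4F ∷ [])
  ∷ row 1F (3F ∷ 5F ∷ 7F ∷ [])
  ∷ row 2F (0F ∷ 1F ∷ 4F ∷ [])
  ∷ row 2F (3F ∷ 5F ∷ 7F ∷ [])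
  ∷ row 3F (0F ∷ 1F ∷ 4F ∷ [])
  ∷ row 3F (3F ∷ 5F ∷ 7F ∷ [])
  ∷ row 4F (0F ∷ 1F ∷ 4F ∷ [])
  ∷ row 4F (3F ∷ 5F ∷ 7F ∷ [])
  ∷ row 5F (0F ∷ 1F ∷ 4F ∷ [])
  ∷ row 5F (3F ∷ 5F ∷ 7F ∷ [])
  ∷ col 2F (0F ∷ 1F ∷ [])
  ∷ col 2F (2F ∷ [])
  ∷ col 2F (3F ∷ 5F ∷ [])
  ∷ col 2F (4F ∷ [])
  ∷ col 6F (0F ∷ 1F ∷ [])
  ∷ col 6F (2F ∷ [])
  ∷ col 6F (3F ∷ 5F ∷ [])
  ∷ col 6F (4F ∷ [])
  ∷ [])

cover-isCovering : HasCoveringOfSize P Q 20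
cover-isCovering = (λ i → uniantichain (cover i) (antichains i)) , covers
  where
  antichains : ∀ i → IsAntichainLine (cover i)
  antichains = toWitness {a? = all? (isAntichainLine? ∘ cover)} _
  covers : ∀ x → ∃ λ i → x ∈ᴸ cover i
  covers (p , q) = toWitness {a? = all? λ p → all? λ q → any? λ i → (p , q) ∈ᴸ? cover i} _ p q

doubleCover : Fin 39 → Line
doubleCover = lookup
  ( row 0F (0F ∷ 1F ∷ 4F ∷ [])
  ∷ row 0F (1F ∷ 2F ∷ 4F ∷ [])
  ∷ row 0F (3F ∷ 5F ∷ 7F ∷ [])
  ∷ row 0F (3F ∷ 5F ∷ 7F ∷ [])
  ∷ row 1F (1F ∷ 2F ∷ 4F ∷ [])
  ∷ row 1F (3F ∷ 4F ∷ 7F ∷ [])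
  ∷ row 1F (3F ∷ 5F ∷ 7F ∷ [])
  ∷ row 2F (1F ∷ 2F ∷ 4F ∷ [])
  ∷ row 2F (0F ∷ 3F ∷ 4F ∷ [])
  ∷ row 2F (2F ∷ 3F ∷ 4F ∷ [])
  ∷ row 2F (1F ∷ 5F ∷ [])
  ∷ row 2F (6F ∷ 7F ∷ [])
  ∷ row 2F (6F ∷ 7F ∷ [])
  ∷ row 3F (0F ∷ 1F ∷ 4F ∷ [])
  ∷ row 3F (0F ∷ 1F ∷ 4F ∷ [])
  ∷ row 3F (3F ∷ 5F ∷ 7F ∷ [])
  ∷ row 3F (3F ∷ 5F ∷ 7F ∷ [])
  ∷ row 4F (1F ∷ 2F ∷ 4F ∷ [])
  ∷ row 4F (0F ∷ 3F ∷ 4F ∷ [])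
  ∷ row 4F (2F ∷ 3F ∷ 4F ∷ [])
  ∷ row 4F (1F ∷ 5F ∷ [])
  ∷ row 4F (6F ∷ 7F ∷ [])
  ∷ row 4F (6F ∷ 7F ∷ [])
  ∷ row 5F (0F ∷ 1F ∷ 4F ∷ [])
  ∷ row 5F (3F ∷ 4F ∷ 7F ∷ [])
  ∷ row 5F (3F ∷ 5F ∷ 7F ∷ [])
  ∷ col 0F (0F ∷ 1F ∷ [])
  ∷ col 0F (1F ∷ 2F ∷ [])
  ∷ col 0F (4F ∷ 5F ∷ [])
  ∷ col 1F (1F ∷ 5F ∷ [])
  ∷ col 2F (0F ∷ 1F ∷ [])
  ∷ col 2F (3F ∷ 5F ∷ [])
  ∷ col 2F (3F ∷ 5F ∷ [])
  ∷ col 5F (1F ∷ 2F ∷ [])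
  ∷ col 5F (4F ∷ 5F ∷ [])
  ∷ col 6F (0F ∷ 1F ∷ [])
  ∷ col 6F (0F ∷ 1F ∷ [])
  ∷ col 6F (3F ∷ 5F ∷ [])
  ∷ col 6F (3F ∷ 5F ∷ [])
  ∷ [])

doubleCover-antichains : ∀ t → IsAntichainLine (doubleCover t)
doubleCover-antichains = toWitness {a? = all? (isAntichainLine? ∘ doubleCover)} _

doubleCover-covers-twice : ∀ x → 2 ≤ multiplicity doubleCover x
doubleCover-covers-twice (p , q) =
  toWitness {a? = all? λ p → all? λ q → 2 ≤? multiplicity doubleCover (p , q)} _ p q

semichain : List (Pair P Q)
semichain = (0F , 0F) ∷ (0F , 2F) ∷ (0F , 5F) ∷ (0F , 6F) ∷ (1F , 1F) ∷ (1F , 3F) ∷ (2F , 0F)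
          ∷ (2F , 2F) ∷ (2F , 5F) ∷ (2F , 6F) ∷ (3F , 0F) ∷ (3F , 2F) ∷ (3F , 5F) ∷ (3F , 6F)
          ∷ (4F , 0F) ∷ (4F , 2F) ∷ (4F , 5F) ∷ (4F , 6F) ∷ (5F , 4F) ∷ []

semichain-isSemichain : IsSemichain P Q semichain
semichain-isSemichain = separated⇒semichain
  (toWitness {a? = allPairs? (λ x y → ¬? (≡-dec _≟_ _≟_ x y)) semichain} _)
  (toWitness {a? = All.all? (λ x → All.all? (separated? x) semichain) semichain} _)

total-weight : total weight ≡ 39
total-weight = refl

covers-need-20 : ∀ k → HasCoveringOfSize P Q k → 20 ≤ k
covers-need-20 k covering = *-cancelʳ-< 2 19 k
  (subst (_≤ k * 2) total-weight (total-weight-≤-cover-size {weight} weight-bound covering))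

semichains-≤19 : ∀ Ts → IsSemichain P Q Ts → length Ts ≤ 19
semichains-≤19 Ts Ts-semichain = ≤-pred (*-cancelʳ-< 2 (length Ts) 20 (s≤s
  (semichain-length-≤ doubleCover doubleCover-antichains doubleCover-covers-twice Ts-semichain)))

mainTheorem9 : Σ FinPoset λ P → Σ FinPoset λ Q → Σ ℕ λ k → Σ ℕ λ s →
    IsMinCoverNumber P Q k × IsMaxSemichainSize P Q s × (s < k)
mainTheorem9 = P , Q , 20 , 19
  , (cover-isCovering , covers-need-20)
  , ((semichain , semichain-isSemichain , refl) , semichains-≤19)
  , ≤-refl
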